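{- Let $k,d\in\mathbb{N}$ and let $T$ be an out-arborescence with root $r$ such that $d_T^+(r)\ge d$. Suppose that for every directed path in $T$ with vertex sequence $r=v_1,\dots,v_h$ from $r$ to a leaf $v_h$, it holds that $d_T^+(v_i)\ge d$ for every index $i$ with $\max\{1,h-k+1\}\le i\le h-1$. Then $T$ contains a $(k-1,\lceil d/k\rceil)$-broom rooted at $r$ all of whose leaves are leaves of $T$.
   Context: An out-arborescence is an oriented tree with a designated root such that all arcs are oriented away from the root; it is balanced if all root-to-leaf paths have the same length, and its height is the maximum length of a root-to-leaf path. For $k,d\in\mathbb{N}$, a $(k,d)$-broom rooted at $r$ is an out-arborescence $T$ with root $r$ for which there is an integer $1\le \ell\le k+1$ such that either (i) $\ell\le k$ and $T$ is a balanced out-arborescence of height $\ell$ in which every non-leaf vertex has out-degree exactly $d$; or (ii) $\ell=k+1$ and $T$ is obtained from a balanced out-arborescence of height $k+1$ in which every non-leaf vertex has out-degree exactly $d$ by subdividing each out-arc of $r$ an arbitrary number of times. -}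

module Defs where

open import Data.Nat using (ℕ; zero; suc; _+_; _∸_; _≤_; _⊔_; NonZero)
open import Data.Nat.DivMod using (_/_)
open import Data.List using (List; []; _∷_; length; lookup)
open import Data.List.Relation.Unary.All using (All)
open import Data.List.Membership.Propositional using (_∈_)
open import Data.Fin using (Fin; toℕ)
open import Data.Product using (Σ; _×_; ∃)
open import Data.Sum using (_⊎_)
open import Function.Definitions using (Injective)
open import Relation.Binary.PropositionalEquality using (_≡_)

-- A finite out-arborescence, represented as a rooted (rose) tree:
-- a vertex together with the list of its out-neighbours' subtrees.
data Tree : Set where
  node : List Tree → Tree

children : Tree → List Tree
children (node ts) = ts

outdeg : Tree → ℕ
outdeg t = length (children t)

⌈_/_⌉ : (d k : ℕ) → .{{NonZero k}} → ℕ
⌈ d / k ⌉ = (d + k ∸ 1) / k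

-- Vertex sequences (as the list of subtrees rooted at v₁,…,v_h) of
-- directed paths from the root to a leaf.
data RootLeafPath : Tree → List Tree → Set where
  leaf : RootLeafPath (node []) (node [] ∷ [])
  step : ∀ {t ts p} → t ∈ ts → RootLeafPath t p →
         RootLeafPath (node ts) (node ts ∷ p)

Complete : ℕ → ℕ → Tree → Set
Complete d zero    t = outdeg t ≡ 0
Complete d (suc ℓ) t = outdeg t ≡ d × All (Complete d ℓ) (children t)

-- t is obtained from a tree satisfying P by prepending a directed path
-- of arbitrary length (0 or more subdivision vertices of the arc into it).
data Subdiv (P : Tree → Set) : Tree → Set where
  here  : ∀ {t} → P t → Subdiv P t
  there : ∀ {t} → Subdiv P t → Subdiv P (node (t ∷ []))

-- (k,d)-broom (rooted at the root of the tree).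
-- (i)  balanced, height ℓ with 1 ≤ ℓ ≤ k, all non-leaves out-degree d;
-- (ii) balanced of height k+1 with all non-leaves out-degree d, each
--      out-arc of the root subdivided an arbitrary number of times.
Broom : ℕ → ℕ → Tree → Set
Broom k d t =
  (Σ ℕ λ ℓ → 1 ≤ ℓ × ℓ ≤ k × Complete d ℓ t)
  ⊎ (outdeg t ≡ d × All (Subdiv (Complete d k)) (children t))

-- S ⊑ T : S is (isomorphic to) a sub-arborescence of T with the same
-- root, such that every leaf of S is a leaf of T.
data _⊑_ : Tree → Tree → Set where
  leaf⊑   : node [] ⊑ node []
  branch⊑ : ∀ {s ss ts}
            (f : Fin (length (s ∷ ss)) → Fin (length ts)) →
            Injective _≡_ _≡_ f →
            (∀ i → lookup (s ∷ ss) i ⊑ lookup ts (f i)) →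
            node (s ∷ ss) ⊑ node ts

PathCond : ℕ → ℕ → Tree → Set
PathCond k d T =
  ∀ p → RootLeafPath T p → (i : Fin (length p)) →
  1 ⊔ (length p + 1 ∸ k) ≤ suc (toℕ i) →
  suc (toℕ i) ≤ length p ∸ 1 →
  d ≤ outdeg (lookup p i)

-- Write k = m + 1 and c = ⌈d/k⌉, so that k(c − 1) < d.  Bottom-up, every vertex v receives a
-- "stage" x ≤ m: a sub-arborescence rooted at v, with leaves among the leaves of T, that is either
-- complete c-ary of height x < m, or (x = m) complete c-ary of height m behind a subdivided
-- in-arc.  A leaf has stage 0.  If d⁺(v) ≥ d, the k(c − 1) < d⁺(v) children fall into k stages,
-- so c of them share a stage x; joining them gives stage x + 1 (for x = m, one of them behind the
-- arc into v suffices).  If d⁺(v) < d, any child has a stage x = m, which the arc into v extends: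
-- a complete child of height x < m would give a leaf at distance x + 1 < k from v, where the
-- hypothesis forces d⁺(v) ≥ d.  At the root, whose degree is at least d, the common stage of c
-- children yields the broom.
module Submission where

open import Defs
open import Data.Nat
  using (ℕ; zero; suc; _+_; _*_; _∸_; _⊔_; _≤_; _<_; z≤n; s≤s; s≤s⁻¹; _≤?_; _<?_; NonZero; ≢-nonZero⁻¹)
open import Data.Nat.Properties
  using ( ≤-refl; ≤-reflexive; ≤-trans; <-irrefl; ≮⇒≥; m<n⇒m<1+n; m≤n⇒m<n∨m≡n; module ≤-Reasoning
        ; +-comm; +-suc; +-identityʳ; +-monoˡ-≤; +-monoʳ-≤; +-cancelˡ-<; m≤n+m; m≤n+m∸n
        ; m+n∸n≡m; m≤n+o⇒m∸n≤o; *-comm; ⊔-lub; m≤n⊔m; m≤n⇒m⊓n≡m )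
open import Data.Nat.DivMod using (_/_; m/n*n≤m; m/n≡1+[m∸n]/n)
open import Data.Fin as Fin using (Fin; toℕ)
open import Data.Fin.Properties using (suc-injective)
open import Data.List using (List; []; _∷_; length; lookup; take)
open import Data.List.Properties using (length-take)
open import Data.List.Relation.Unary.All as All using (All; []; _∷_)
open import Data.List.Relation.Unary.All.Properties using (take⁺)
open import Data.List.Relation.Unary.Any using (here)
open import Data.List.Membership.Propositional using (_∈_)
open import Data.List.Membership.Propositional.Properties using (∈-lookup)
open import Data.List.Relation.Binary.Sublist.Heterogeneous using (Sublist; []; _∷_; _∷ʳ_; minimum)
open import Data.List.Relation.Binary.Sublist.Heterogeneous.Properties
  using (take-Sublist) renaming (trans to Sublist-trans)
open import Data.List.Relation.Binary.Sublist.Propositional using (_⊆_)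
open import Data.Product using (Σ; _×_; ∃-syntax; _,_)
open import Data.Sum using (inj₁; inj₂)
open import Data.Empty using (⊥-elim; ⊥-elim-irr)
open import Relation.Nullary using (yes; no)
open import Relation.Binary.PropositionalEquality using (_≡_; refl; sym; trans; cong; subst; module ≡-Reasoning)
open import Function.Definitions using (Injective)

⌈1+d/k⌉≡1+d/k : ∀ d k .{{_ : NonZero k}} → ⌈ suc d / k ⌉ ≡ suc (d / k)
⌈1+d/k⌉≡1+d/k d k = begin
  (d + k) / k           ≡⟨ m/n≡1+[m∸n]/n (m≤n+m k d) ⟩
  suc ((d + k ∸ k) / k) ≡⟨ cong (λ n → suc (n / k)) (m+n∸n≡m d k) ⟩
  suc (d / k)           ∎
  where open ≡-Reasoning

k*[d/k]≤d : ∀ d k .{{_ : NonZero k}} → k * (d / k) ≤ d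
k*[d/k]≤d d k = ≤-trans (≤-reflexive (*-comm k (d / k))) (m/n*n≤m d k)

module _ {A B : Set} {R : A → B → Set} where

  Sublist-index : ∀ {as bs} → Sublist R as bs → Fin (length as) → Fin (length bs)
  Sublist-index (_ ∷ʳ σ) i            = Fin.suc (Sublist-index σ i)
  Sublist-index (_ ∷ σ)  Fin.zero     = Fin.zero
  Sublist-index (_ ∷ σ)  (Fin.suc i)  = Fin.suc (Sublist-index σ i)

  Sublist-index-injective : ∀ {as bs} (σ : Sublist R as bs) → Injective _≡_ _≡_ (Sublist-index σ)
  Sublist-index-injective (_ ∷ʳ σ) eq = Sublist-index-injective σ (suc-injective eq)
  Sublist-index-injective (_ ∷ σ) {Fin.zero}  {Fin.zero}  eq = refl
  Sublist-index-injective (_ ∷ σ) {Fin.suc i} {Fin.suc j} eq =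
    cong Fin.suc (Sublist-index-injective σ (suc-injective eq))

  Sublist-lookup : ∀ {as bs} (σ : Sublist R as bs) i → R (lookup as i) (lookup bs (Sublist-index σ i))
  Sublist-lookup (_ ∷ʳ σ) i           = Sublist-lookup σ i
  Sublist-lookup (r ∷ σ)  Fin.zero    = r
  Sublist-lookup (_ ∷ σ)  (Fin.suc i) = Sublist-lookup σ i

node-⊑ : ∀ {s ss ts} → Sublist _⊑_ (s ∷ ss) ts → node (s ∷ ss) ⊑ node ts
node-⊑ σ = branch⊑ (Sublist-index σ) (Sublist-index-injective σ) (Sublist-lookup σ)

module Pigeonhole {A B : Set} (P : ℕ → A → Set) (R : A → B → Set) where

  Classified : ℕ → B → Set
  Classified n b = ∃[ x ] x < n × ∃[ a ] P x a × R a b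

  take-exactly : ∀ {x} q {as bs} → q < length as → All (P x) as → Sublist R as bs →
                 ∃[ a ] ∃[ as′ ] length as′ ≡ q × All (P x) (a ∷ as′) × Sublist R (a ∷ as′) bs
  take-exactly q {a ∷ as} (s≤s q≤∣as∣) (pa ∷ pas) σ =
    a , take q as , trans (length-take q as) (m≤n⇒m⊓n≡m q≤∣as∣) , pa ∷ take⁺ q pas ,
    take-Sublist (suc q) σ

  partition : ∀ n {bs} → All (Classified (suc n)) bs →
              ∃[ as ] All (P n) as × Sublist R as bs ×
              ∃[ cs ] All (Classified n) cs × cs ⊆ bs × length bs ≤ length as + length cs
  partition n [] = [] , [] , [] , [] , [] , [] , z≤n
  partition n {b ∷ _} ((x , x<1+n , a , pa , ra) ∷ cls)
    with partition n cls | m≤n⇒m<n∨m≡n (s≤s⁻¹ x<1+n)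
  ... | as , pas , σ , cs , clcs , τ , ∣bs∣≤ | inj₂ refl =
    a ∷ as , pa ∷ pas , ra ∷ σ , cs , clcs , b ∷ʳ τ , s≤s ∣bs∣≤
  ... | as , pas , σ , cs , clcs , τ , ∣bs∣≤ | inj₁ x<n =
    as , pas , b ∷ʳ σ , b ∷ cs , (x , x<n , a , pa , ra) ∷ clcs , refl ∷ τ ,
    ≤-trans (s≤s ∣bs∣≤) (≤-reflexive (sym (+-suc (length as) (length cs))))

  pigeonhole : ∀ n q {bs} → All (Classified n) bs → n * q < length bs →
               ∃[ x ] x < n × ∃[ a ] ∃[ as ] length as ≡ q × All (P x) (a ∷ as) × Sublist R (a ∷ as) bs
  pigeonhole zero    q [] ()
  pigeonhole zero    q ((_ , () , _) ∷ _) _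
  pigeonhole (suc n) q cls nq<∣bs∣ with partition n cls
  ... | as , pas , σ , cs , clcs , τ , ∣bs∣≤ with q <? length as
  ...   | yes q<∣as∣ = n , ≤-refl , take-exactly q q<∣as∣ pas σ
  ...   | no  q≮∣as∣ with pigeonhole n q clcs nq<∣cs∣
    where
    nq<∣cs∣ : n * q < length cs
    nq<∣cs∣ = +-cancelˡ-< q (n * q) (length cs)
      (≤-trans nq<∣bs∣ (≤-trans ∣bs∣≤ (+-monoˡ-≤ (length cs) (≮⇒≥ q≮∣as∣))))
  ...     | x , x<n , a , as′ , ∣as′∣ , pas′ , σ′ =
    x , m<n⇒m<1+n x<n , a , as′ , ∣as′∣ , pas′ , Sublist-trans (λ { r refl → r }) σ′ τ

rootLeafPath-nonempty : ∀ {t p} → RootLeafPath t p → 1 ≤ length p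
rootLeafPath-nonempty leaf       = s≤s z≤n
rootLeafPath-nonempty (step _ _) = s≤s z≤n

rootLeafPath-⊒Complete : ∀ {c} x {s t} → Complete (suc c) x s → s ⊑ t →
                         ∃[ p ] RootLeafPath t p × length p ≡ suc x
rootLeafPath-⊒Complete zero    {node []}    _  leaf⊑ = _ , leaf , refl
rootLeafPath-⊒Complete (suc x) {node (_ ∷ _)} (_ , cs ∷ _) (branch⊑ f _ s⊑)
  with rootLeafPath-⊒Complete x cs (s⊑ Fin.zero)
... | p , rp , ∣p∣ = _ , step (∈-lookup (f Fin.zero)) rp , cong suc ∣p∣

window-lower : ∀ {h k i} → h ≤ k + i → 1 ⊔ (h + 1 ∸ k) ≤ suc i
window-lower {h} {k} {i} h≤k+i = ⊔-lub (s≤s z≤n) (m≤n+o⇒m∸n≤o (h + 1) k (begin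
  h + 1       ≡⟨ +-comm h 1 ⟩
  suc h       ≤⟨ s≤s h≤k+i ⟩
  suc (k + i) ≡⟨ +-suc k i ⟨
  k + suc i   ∎))
  where open ≤-Reasoning

window-lower⁻¹ : ∀ {h k i} → 1 ⊔ (h + 1 ∸ k) ≤ suc i → h ≤ k + i
window-lower⁻¹ {h} {k} {i} lo = s≤s⁻¹ (begin
  suc h             ≡⟨ +-comm 1 h ⟩
  h + 1             ≤⟨ m≤n+m∸n (h + 1) k ⟩
  k + (h + 1 ∸ k)   ≤⟨ +-monoʳ-≤ k (≤-trans (m≤n⊔m 1 (h + 1 ∸ k)) lo) ⟩
  k + suc i         ≡⟨ +-suc k i ⟩
  suc (k + i)       ∎)
  where open ≤-Reasoning

window-upper⁻¹ : ∀ {h i} → suc i ≤ h ∸ 1 → suc (suc i) ≤ h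
window-upper⁻¹ {suc h} i<h = s≤s i<h

-- Prepending the parent shifts h and i by one, which keeps i inside the window.
PathCond-child : ∀ {k d ts t} → PathCond k d (node ts) → t ∈ ts → PathCond k d t
PathCond-child {k} pc t∈ts p rp i lo hi =
  pc (_ ∷ p) (step t∈ts rp) (Fin.suc i)
     (window-lower (≤-trans (s≤s (window-lower⁻¹ {k = k} lo))
                            (≤-reflexive (sym (+-suc k (toℕ i))))))
     (window-upper⁻¹ hi)

PathCond-children : ∀ {k d ts} → PathCond k d (node ts) → All (PathCond k d) ts
PathCond-children {k} {d} pc = All.tabulate (PathCond-child {k} {d} pc)

PathCond-degree : ∀ {k d ts t p} → PathCond k d (node ts) → t ∈ ts → RootLeafPath t p →
                  length p < k → d ≤ length ts
PathCond-degree {k} pc t∈ts rp ∣p∣<k =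
  pc (_ ∷ _) (step t∈ts rp) Fin.zero
     (window-lower (≤-trans ∣p∣<k (≤-reflexive (sym (+-identityʳ k)))))
     (rootLeafPath-nonempty rp)

-- Here k = m + 1 and c = q + 1.
module Brooms (m q d : ℕ) (k[c-1]<d : suc m * q < d) where

  data Stage : ℕ → Tree → Set where
    complete   : ∀ {x s} → x < m → Complete (suc q) x s → Stage x s
    subdivided : ∀ {s} → Subdiv (Complete (suc q) m) s → Stage m s

  stage : ∀ {x s} → x ≤ m → Complete (suc q) x s → Stage x s
  stage x≤m cs with m≤n⇒m<n∨m≡n x≤m
  ... | inj₁ x<m  = complete x<m cs
  ... | inj₂ refl = subdivided (here cs)

  Stage⇒Complete : ∀ {x s} → x < m → Stage x s → Complete (suc q) x s
  Stage⇒Complete _   (complete _ cs) = cs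
  Stage⇒Complete m<m (subdivided _)  = ⊥-elim (<-irrefl refl m<m)

  Stage⇒Subdiv : ∀ {s} → Stage m s → Subdiv (Complete (suc q) m) s
  Stage⇒Subdiv (complete m<m _) = ⊥-elim (<-irrefl refl m<m)
  Stage⇒Subdiv (subdivided sd)  = sd

  open Pigeonhole Stage _⊑_

  Staged : Tree → Set
  Staged = Classified (suc m)

  staged-subdivided : ∀ {s ts} → Subdiv (Complete (suc q) m) s → Sublist _⊑_ (s ∷ []) ts →
                      Staged (node ts)
  staged-subdivided sd σ = m , ≤-refl , _ , subdivided (there sd) , node-⊑ σ

  staged : ∀ t → PathCond (suc m) d t → Staged t
  all-staged : ∀ ts → All (PathCond (suc m) d) ts → All Staged ts

  all-staged []       []         = []
  all-staged (t ∷ ts) (pc ∷ pcs) = staged t pc ∷ all-staged ts pcs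

  staged (node [])       _  = 0 , s≤s z≤n , node [] , stage z≤n refl , leaf⊑
  staged (node (u ∷ us)) pc with all-staged (u ∷ us) (PathCond-children {suc m} pc) | d ≤? suc (length us)
  ... | sts | yes d≤deg with pigeonhole (suc m) q sts (≤-trans k[c-1]<d d≤deg)
  ...   | x , x<1+m , s , ss , ∣ss∣ , st , σ with m≤n⇒m<n∨m≡n (s≤s⁻¹ x<1+m)
  ...     | inj₁ x<m  = suc x , s≤s x<m , node (s ∷ ss) ,
                        stage x<m (cong suc ∣ss∣ , All.map (Stage⇒Complete x<m) st) , node-⊑ σ
  ...     | inj₂ refl = staged-subdivided (Stage⇒Subdiv (All.head st)) (take-Sublist 1 σ)
  staged (node (u ∷ us)) pc | (_ , _ , s , subdivided sd , s⊑u) ∷ _ | no _ =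
    staged-subdivided sd (s⊑u ∷ minimum us)
  staged (node (u ∷ us)) pc | (x , _ , s , complete x<m cs , s⊑u) ∷ _ | no d≰deg
    with rootLeafPath-⊒Complete x cs s⊑u
  ... | p , rp , ∣p∣ =
    ⊥-elim (d≰deg (PathCond-degree pc (here refl) rp (≤-trans (≤-reflexive (cong suc ∣p∣)) (s≤s x<m))))

  broom : ∀ T → d ≤ outdeg T → PathCond (suc m) d T → Σ Tree λ B → Broom m (suc q) B × B ⊑ T
  broom (node ts) d≤deg pc
    with pigeonhole (suc m) q (all-staged ts (PathCond-children {suc m} pc)) (≤-trans k[c-1]<d d≤deg)
  ... | x , x<1+m , s , ss , ∣ss∣ , st , σ with m≤n⇒m<n∨m≡n (s≤s⁻¹ x<1+m)
  ...   | inj₁ x<m  = node (s ∷ ss) ,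
                      inj₁ (suc x , s≤s z≤n , x<m , cong suc ∣ss∣ , All.map (Stage⇒Complete x<m) st) , node-⊑ σ
  ...   | inj₂ refl = node (s ∷ ss) , inj₂ (cong suc ∣ss∣ , All.map Stage⇒Subdiv st) , node-⊑ σ

lemma2p5 : (k d : ℕ) → .{{_ : NonZero k}} → 1 ≤ d →
           (T : Tree) → d ≤ outdeg T → PathCond k d T →
           Σ Tree λ B → Broom (k ∸ 1) ⌈ d / k ⌉ B × B ⊑ T
lemma2p5 zero    _       _ = ⊥-elim-irr (≢-nonZero⁻¹ 0 refl)
lemma2p5 (suc m) (suc d) _ T d≤deg pc =
  subst (λ c → Σ Tree λ B → Broom m c B × B ⊑ T) (sym (⌈1+d/k⌉≡1+d/k d (suc m)))
        (Brooms.broom m (d / suc m) (suc d) (s≤s (k*[d/k]≤d d (suc m))) T d≤deg pc)
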